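{- Let $p$ be a prime, $\delta \in (0,1)$ and $T > 1$ real parameters. Then for any sets $X, Y \subseteq \mathbb{F}_p$ with $|X| = \kappa p$ there exists $E \subseteq \mathbb{F}_p$ with $|E| \leqslant |X|/T$ such that $$(X \setminus E) \cap \Big(Y +_{\delta T/\kappa} \big(\mathbb{F}_p \setminus (X -_{\delta} Y)\big)\Big) = \varnothing.$$
   Context: For $U,V\subseteq\mathbb{F}_p$ and $\epsilon>0$: $r_{U+V}(z) = \#\{(u,v)\in U\times V: u+v=z\}$ and $U +_\epsilon V := \{z : r_{U+V}(z)\geqslant \epsilon p,\ r_{U+V}(z)>0\}$; similarly $r_{U-V}(z) = \#\{(u,v)\in U\times V : u-v = z\}$ and $U -_\epsilon V := \{z : r_{U-V}(z) \geqslant \epsilon p,\ r_{U-V}(z)>0\}$.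
   Formalization: The parameters δ and T range over the rationals rather than the reals. -}

module Defs where

open import Data.Nat using (ℕ; NonZero; _∸_; _>_)
import Data.Nat as ℕ
open import Data.Nat.DivMod using (_mod_)
open import Data.Fin using (Fin; toℕ)
open import Data.Fin.Subset using (Subset)
open import Data.Fin.Subset.Properties using (_∈?_)
open import Data.Vec using (tabulate)
open import Data.List using (List; length; filter; cartesianProduct; allFin)
open import Data.Product using (_×_; _,_)
open import Data.Bool using (Bool)
open import Data.Integer using (+_)
open import Data.Rational using (ℚ; _/_; _*_; _≤_)
import Data.Rational.Properties as ℚP
import Data.Fin.Properties as FinP
open import Relation.Nullary using (Dec; _×-dec_; does)
open import Relation.Binary.PropositionalEquality using (_≡_)

⟦_⟧ : ℕ → ℚ
⟦ n ⟧ = + n / 1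

module _ (p : ℕ) .{{_ : NonZero p}} where

  _+ₚ_ : Fin p → Fin p → Fin p
  u +ₚ v = (toℕ u ℕ.+ toℕ v) mod p

  _-ₚ_ : Fin p → Fin p → Fin p
  u -ₚ v = (toℕ u ℕ.+ (p ∸ toℕ v)) mod p

  r+ : Subset p → Subset p → Fin p → ℕ
  r+ U V z = length (filter (λ { (u , v) → (u ∈? U) ×-dec ((v ∈? V) ×-dec (FinP._≟_ (u +ₚ v) z)) })
                            (cartesianProduct (allFin p) (allFin p)))

  r- : Subset p → Subset p → Fin p → ℕ
  r- U V z = length (filter (λ { (u , v) → (u ∈? U) ×-dec ((v ∈? V) ×-dec (FinP._≟_ (u -ₚ v) z)) })
                            (cartesianProduct (allFin p) (allFin p)))

  sumε : Subset p → ℚ → Subset p → Subset p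
  sumε U ε V = tabulate (λ z → does ((ε * ⟦ p ⟧ ℚP.≤? ⟦ r+ U V z ⟧) ×-dec (r+ U V z ℕ.>? 0)))

  diffε : Subset p → ℚ → Subset p → Subset p
  diffε U ε V = tabulate (λ z → does ((ε * ⟦ p ⟧ ℚP.≤? ⟦ r- U V z ⟧) ×-dec (r- U V z ℕ.>? 0)))

-- Take E := X ∩ (Y +_ε C) with C := F_p ∖ (X -_δ Y) and ε := δT/κ; the emptiness
-- claim then holds by construction.  Every z ∈ E has at least εp representations
-- z = y + c with y ∈ Y, c ∈ C, and each of them gives a representation c = z - y
-- with z ∈ X.  Hence |E|·εp ≤ Σ_{c ∈ C} r_{X-Y}(c) ≤ p·δp, the last step because
-- r_{X-Y}(c) < δp off X -_δ Y.  Dividing by εp gives |E| ≤ κp/T = |X|/T.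
module Submission where

open import Defs
import Algebra.Properties.Semiring.Sum as Sum
open import Data.Bool using (true; false; if_then_else_)
open import Data.Fin using (Fin; toℕ)
import Data.Fin as Fin
import Data.Fin.Properties as FinP
open import Data.Fin.Subset using (Subset; ∣_∣; ∁; _∩_; _─_; ⊥; _∈_; _∉_; _⊆_)
open import Data.Fin.Subset.Properties using (_∈?_; p∩q⊆p; x∈p∩q⁻; x∈∁p⇒x∉p)
open import Data.Integer using (+_)
import Data.Integer as ℤ
import Data.Integer.Properties as ℤP
open import Data.List using (List; []; _∷_; length; filter; cartesianProduct; allFin; map; _++_) renaming (tabulate to tabulateᴸ)
import Data.List.Properties as ListP
open import Data.Nat using (ℕ; zero; suc; NonZero; z≤n; s≤s; _∸_)
import Data.Nat as ℕ
import Data.Nat.Coprimality as Coprime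
open import Data.Nat.ListAction renaming (sum to sumᴸ)
open import Data.Nat.ListAction.Properties using (sum-++)
open import Data.Nat.DivMod using (_mod_; _%_; %-distribˡ-+; m%n%n≡m%n; [m+n]%n≡m%n; m<n⇒m%n≡m)
open import Data.Nat.Primality using (Prime)
import Data.Nat.Properties as ℕP
open import Data.Product using (Σ; _×_; _,_; proj₁; proj₂)
open import Data.Rational using (ℚ; mkℚ; 0ℚ; 1ℚ; _+_; _*_; _/_; _÷_; _≤_; _<_; 1/_)
import Data.Rational as ℚ
import Data.Rational.Properties as ℚP
open import Data.Rational.Solver using (module +-*-Solver)
open import Data.Vec using ([]; _∷_; tabulate)
open import Data.Vec.Properties using (lookup∘tabulate; []=⇒lookup; lookup⇒[]=)
open import Function using (_∘_)
open import Relation.Nullary using (Dec; yes; no; does; proof; ¬_; _×-dec_; contradiction)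
open import Relation.Nullary.Decidable using (dec-true)
open import Relation.Nullary.Reflects using (Reflects; invert)
open import Relation.Unary using (Decidable)
open import Relation.Binary.PropositionalEquality

open Sum ℕP.+-*-semiring using (sum; sum-syntax; ∑-comm; *-distribˡ-sum; sum-cong-≗)

private
  variable
    A B : Set
    n : ℕ

𝟙 : Dec A → ℕ
𝟙 a = if does a then 1 else 0

𝟙-× : (a : Dec A) (b : Dec B) → 𝟙 (a ×-dec b) ≡ 𝟙 a ℕ.* 𝟙 b
𝟙-× (yes _) b = sym (ℕP.+-identityʳ (𝟙 b))
𝟙-× (no _)  b = refl

𝟙-mono : (A → B) → (a : Dec A) (b : Dec B) → 𝟙 a ℕ.≤ 𝟙 b
𝟙-mono f (no _)  b       = z≤n
𝟙-mono f (yes _) (yes _) = ℕP.≤-refl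
𝟙-mono f (yes a) (no ¬b) = contradiction (f a) ¬b

∑-mono-≤ : {f g : Fin n → ℕ} → (∀ i → f i ℕ.≤ g i) → sum f ℕ.≤ sum g
∑-mono-≤ {zero}  f≤g = z≤n
∑-mono-≤ {suc n} f≤g = ℕP.+-mono-≤ (f≤g Fin.zero) (∑-mono-≤ (f≤g ∘ Fin.suc))

∣∣≡∑𝟙 : (S : Subset n) → ∣ S ∣ ≡ ∑[ i < n ] 𝟙 (i ∈? S)
∣∣≡∑𝟙 []          = refl
∣∣≡∑𝟙 (true ∷ S)  = cong suc (∣∣≡∑𝟙 S)
∣∣≡∑𝟙 (false ∷ S) = ∣∣≡∑𝟙 S

length-filter≡sum-𝟙 : {P : A → Set} (P? : Decidable P) (xs : List A) →
                      length (filter P? xs) ≡ sumᴸ (map (𝟙 ∘ P?) xs)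
length-filter≡sum-𝟙 P? []       = refl
length-filter≡sum-𝟙 P? (x ∷ xs) with does (P? x)
... | true  = cong suc (length-filter≡sum-𝟙 P? xs)
... | false = length-filter≡sum-𝟙 P? xs

sum-map-cartesianProduct : (h : A × B → ℕ) (xs : List A) (ys : List B) →
  sumᴸ (map h (cartesianProduct xs ys)) ≡ sumᴸ (map (λ x → sumᴸ (map (λ y → h (x , y)) ys)) xs)
sum-map-cartesianProduct h []       ys = refl
sum-map-cartesianProduct h (x ∷ xs) ys = begin
  sumᴸ (map h (map (x ,_) ys ++ cartesianProduct xs ys))
    ≡⟨ cong sumᴸ (ListP.map-++ h (map (x ,_) ys) (cartesianProduct xs ys)) ⟩
  sumᴸ (map h (map (x ,_) ys) ++ map h (cartesianProduct xs ys))
    ≡⟨ sum-++ (map h (map (x ,_) ys)) _ ⟩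
  sumᴸ (map h (map (x ,_) ys)) ℕ.+ sumᴸ (map h (cartesianProduct xs ys))
    ≡⟨ cong₂ ℕ._+_ (cong sumᴸ (sym (ListP.map-∘ ys))) (sum-map-cartesianProduct h xs ys) ⟩
  sumᴸ (map (λ y → h (x , y)) ys) ℕ.+ sumᴸ (map (λ x → sumᴸ (map (λ y → h (x , y)) ys)) xs) ∎
  where open ≡-Reasoning

sumᴸ-tabulate : (f : Fin n → ℕ) → sumᴸ (tabulateᴸ f) ≡ sum f
sumᴸ-tabulate {zero}  f = refl
sumᴸ-tabulate {suc n} f = cong (f Fin.zero ℕ.+_) (sumᴸ-tabulate (f ∘ Fin.suc))

sum-map-allFin : (f : Fin n → ℕ) → sumᴸ (map f (allFin n)) ≡ sum f
sum-map-allFin f = trans (cong sumᴸ (ListP.map-tabulate (λ i → i) f)) (sumᴸ-tabulate f)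

length-filter-pairs≡∑∑𝟙 : {P : Fin n × Fin n → Set} (P? : Decidable P) →
  length (filter P? (cartesianProduct (allFin n) (allFin n))) ≡ ∑[ u < n ] ∑[ v < n ] 𝟙 (P? (u , v))
length-filter-pairs≡∑∑𝟙 {n} P? = begin
  length (filter P? (cartesianProduct (allFin n) (allFin n)))
    ≡⟨ length-filter≡sum-𝟙 P? (cartesianProduct (allFin n) (allFin n)) ⟩
  sumᴸ (map (𝟙 ∘ P?) (cartesianProduct (allFin n) (allFin n)))
    ≡⟨ sum-map-cartesianProduct (𝟙 ∘ P?) (allFin n) (allFin n) ⟩
  sumᴸ (map (λ u → sumᴸ (map (λ v → 𝟙 (P? (u , v))) (allFin n))) (allFin n))
    ≡⟨ sum-map-allFin (λ u → sumᴸ (map (λ v → 𝟙 (P? (u , v))) (allFin n))) ⟩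
  ∑[ u < n ] sumᴸ (map (λ v → 𝟙 (P? (u , v))) (allFin n))
    ≡⟨ sum-cong-≗ (λ u → sum-map-allFin (λ v → 𝟙 (P? (u , v)))) ⟩
  ∑[ u < n ] ∑[ v < n ] 𝟙 (P? (u , v)) ∎
  where open ≡-Reasoning

∈-tabulate-does⁻ : {P : Fin n → Set} (P? : Decidable P) {z : Fin n} →
                   z ∈ tabulate (does ∘ P?) → P z
∈-tabulate-does⁻ {P = P} P? {z} z∈ =
  invert (subst (Reflects (P z)) (trans (sym (lookup∘tabulate (does ∘ P?) z)) ([]=⇒lookup z∈)) (proof (P? z)))

∉-tabulate-does⁻ : {P : Fin n → Set} (P? : Decidable P) {z : Fin n} →
                   z ∉ tabulate (does ∘ P?) → ¬ P z
∉-tabulate-does⁻ P? {z} z∉ pz =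
  z∉ (lookup⇒[]= z _ (trans (lookup∘tabulate (does ∘ P?) z) (dec-true (P? z) pz)))

[p─[p∩q]]∩q≡⊥ : (p q : Subset n) → (p ─ (p ∩ q)) ∩ q ≡ ⊥
[p─[p∩q]]∩q≡⊥ []          []          = refl
[p─[p∩q]]∩q≡⊥ (false ∷ p) (_ ∷ q)     = cong (false ∷_) ([p─[p∩q]]∩q≡⊥ p q)
[p─[p∩q]]∩q≡⊥ (true ∷ p)  (true ∷ q)  = cong (false ∷_) ([p─[p∩q]]∩q≡⊥ p q)
[p─[p∩q]]∩q≡⊥ (true ∷ p)  (false ∷ q) = cong (false ∷_) ([p─[p∩q]]∩q≡⊥ p q)

⟦⟧-homo-+ : ∀ m n → ⟦ m ℕ.+ n ⟧ ≡ ⟦ m ⟧ + ⟦ n ⟧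
⟦⟧-homo-+ m n = begin
  + (m ℕ.+ n) / 1                    ≡⟨ cong (_/ 1) (ℤP.pos-+ m n) ⟩
  (+ m ℤ.+ + n) / 1                  ≡⟨ cong₂ (λ a b → (a ℤ.+ b) / 1) (ℤP.*-identityʳ (+ m)) (ℤP.*-identityʳ (+ n)) ⟨
  (+ m ℤ.* + 1 ℤ.+ + n ℤ.* + 1) / 1  ≡⟨⟩
  fromℕ m + fromℕ n                  ≡⟨ cong₂ _+_ (ℚP.↥p/↧p≡p (fromℕ m)) (ℚP.↥p/↧p≡p (fromℕ n)) ⟨
  ⟦ m ⟧ + ⟦ n ⟧                      ∎
  where
  open ≡-Reasoning
  -- the normal form of ⟦ n ⟧, on which _+_ computes
  fromℕ : ℕ → ℚ
  fromℕ n = mkℚ (+ n) 0 (Coprime.sym (Coprime.1-coprimeTo n))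

⟦⟧-nonNeg : ∀ n → 0ℚ ≤ ⟦ n ⟧
⟦⟧-nonNeg n = ℚP.nonNegative⁻¹ _ {{ℚP.normalize-nonNeg n 1}}

⟦⟧-mono-≤ : ∀ {m n} → m ℕ.≤ n → ⟦ m ⟧ ≤ ⟦ n ⟧
⟦⟧-mono-≤ {m} {n} m≤n = begin
  ⟦ m ⟧                ≡⟨ ℚP.+-identityʳ ⟦ m ⟧ ⟨
  ⟦ m ⟧ + 0ℚ           ≤⟨ ℚP.+-monoʳ-≤ ⟦ m ⟧ (⟦⟧-nonNeg (n ∸ m)) ⟩
  ⟦ m ⟧ + ⟦ n ∸ m ⟧    ≡⟨ ⟦⟧-homo-+ m (n ∸ m) ⟨
  ⟦ m ℕ.+ (n ∸ m) ⟧    ≡⟨ cong ⟦_⟧ (ℕP.m+[n∸m]≡n m≤n) ⟩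
  ⟦ n ⟧                ∎
  where open ℚP.≤-Reasoning

0≤*⟦⟧ : ∀ {q} n → 0ℚ ≤ q → 0ℚ ≤ q * ⟦ n ⟧
0≤*⟦⟧ {q} n 0≤q = ℚP.nonNegative⁻¹ _ {{ℚP.nonNeg*nonNeg⇒nonNeg q {{ℚ.nonNegative 0≤q}} ⟦ n ⟧ {{ℚP.normalize-nonNeg n 1}}}}

¬[a≤⟦k⟧×k>0]⇒⟦k⟧≤a : ∀ {a} k → 0ℚ ≤ a → ¬ (a ≤ ⟦ k ⟧ × k ℕ.> 0) → ⟦ k ⟧ ≤ a
¬[a≤⟦k⟧×k>0]⇒⟦k⟧≤a zero    0≤a _ = 0≤a
¬[a≤⟦k⟧×k>0]⇒⟦k⟧≤a (suc k) _   ¬[a≤k×k>0] = ℚP.<⇒≤ (ℚP.≰⇒> (λ a≤k → ¬[a≤k×k>0] (a≤k , s≤s z≤n)))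

⟦𝟙⟧*-≤-⟦𝟙*⟧ : ∀ {a k} (d : Dec A) → (A → a ≤ ⟦ k ⟧) → ⟦ 𝟙 d ⟧ * a ≤ ⟦ 𝟙 d ℕ.* k ⟧
⟦𝟙⟧*-≤-⟦𝟙*⟧ {a = a}     (no _)  _   = ℚP.≤-reflexive (ℚP.*-zeroˡ a)
⟦𝟙⟧*-≤-⟦𝟙*⟧ {a = a} {k} (yes x) a≤k =
  subst₂ _≤_ (sym (ℚP.*-identityˡ a)) (cong ⟦_⟧ (sym (ℕP.*-identityˡ k))) (a≤k x)

⟦𝟙*⟧-≤ : ∀ {b k} (d : Dec A) → 0ℚ ≤ b → (A → ⟦ k ⟧ ≤ b) → ⟦ 𝟙 d ℕ.* k ⟧ ≤ b
⟦𝟙*⟧-≤         (no _)  0≤b _   = 0≤b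
⟦𝟙*⟧-≤ {k = k} (yes x) _   k≤b = subst (_≤ _) (cong ⟦_⟧ (sym (ℕP.*-identityˡ k))) (k≤b x)

⟦∑⟧*-≤-⟦∑⟧ : ∀ a (f g : Fin n → ℕ) → (∀ i → ⟦ f i ⟧ * a ≤ ⟦ g i ⟧) → ⟦ sum f ⟧ * a ≤ ⟦ sum g ⟧
⟦∑⟧*-≤-⟦∑⟧ {zero}  a f g _     = ℚP.≤-reflexive (ℚP.*-zeroˡ a)
⟦∑⟧*-≤-⟦∑⟧ {suc n} a f g fa≤g = begin
  ⟦ f Fin.zero ℕ.+ sum (f ∘ Fin.suc) ⟧ * a
    ≡⟨ cong (_* a) (⟦⟧-homo-+ (f Fin.zero) _) ⟩
  (⟦ f Fin.zero ⟧ + ⟦ sum (f ∘ Fin.suc) ⟧) * a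
    ≡⟨ ℚP.*-distribʳ-+ a ⟦ f Fin.zero ⟧ _ ⟩
  ⟦ f Fin.zero ⟧ * a + ⟦ sum (f ∘ Fin.suc) ⟧ * a
    ≤⟨ ℚP.+-mono-≤ (fa≤g Fin.zero) (⟦∑⟧*-≤-⟦∑⟧ a (f ∘ Fin.suc) (g ∘ Fin.suc) (fa≤g ∘ Fin.suc)) ⟩
  ⟦ g Fin.zero ⟧ + ⟦ sum (g ∘ Fin.suc) ⟧
    ≡⟨ ⟦⟧-homo-+ (g Fin.zero) _ ⟨
  ⟦ g Fin.zero ℕ.+ sum (g ∘ Fin.suc) ⟧ ∎
  where open ℚP.≤-Reasoning

⟦∑⟧-≤-⟦n⟧* : ∀ b (g : Fin n → ℕ) → (∀ i → ⟦ g i ⟧ ≤ b) → ⟦ sum g ⟧ ≤ ⟦ n ⟧ * b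
⟦∑⟧-≤-⟦n⟧* {zero}  b g _    = ℚP.≤-reflexive (sym (ℚP.*-zeroˡ b))
⟦∑⟧-≤-⟦n⟧* {suc n} b g g≤b = begin
  ⟦ g Fin.zero ℕ.+ sum (g ∘ Fin.suc) ⟧   ≡⟨ ⟦⟧-homo-+ (g Fin.zero) _ ⟩
  ⟦ g Fin.zero ⟧ + ⟦ sum (g ∘ Fin.suc) ⟧ ≤⟨ ℚP.+-mono-≤ (g≤b Fin.zero) (⟦∑⟧-≤-⟦n⟧* b (g ∘ Fin.suc) (g≤b ∘ Fin.suc)) ⟩
  b + ⟦ n ⟧ * b                          ≡⟨ cong (_+ ⟦ n ⟧ * b) (ℚP.*-identityˡ b) ⟨
  1ℚ * b + ⟦ n ⟧ * b                     ≡⟨ ℚP.*-distribʳ-+ b 1ℚ ⟦ n ⟧ ⟨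
  (1ℚ + ⟦ n ⟧) * b                       ≡⟨ cong (_* b) (⟦⟧-homo-+ 1 n) ⟨
  ⟦ suc n ⟧ * b                          ∎
  where open ℚP.≤-Reasoning

nonNeg-*-pos⇒nonNeg : ∀ q r .{{_ : ℚ.Positive r}} → 0ℚ ≤ q * r → 0ℚ ≤ q
nonNeg-*-pos⇒nonNeg q r 0≤qr = ℚP.*-cancelʳ-≤-pos r (subst (_≤ q * r) (sym (ℚP.*-zeroˡ r)) 0≤qr)

e*[δT÷κ*P]≤P*[δ*P]⇒e≤κP÷T : ∀ e δ T κ P .{{_ : ℚ.Positive P}} .{{_ : ℚ.NonZero T}} .{{_ : ℚ.NonZero κ}} →
  0ℚ < δ → 0ℚ < T → 0ℚ ≤ κ * P → e * ((δ * T ÷ κ) * P) ≤ P * (δ * P) → e ≤ κ * P ÷ T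
e*[δT÷κ*P]≤P*[δ*P]⇒e≤κP÷T e δ T κ P 0<δ 0<T 0≤κP e*εP≤PδP =
  ℚP.*-cancelʳ-≤-pos ((δ * T ÷ κ) * P) {{εP-pos}} (subst (e * ((δ * T ÷ κ) * P) ≤_) PδP≡κP÷T*εP e*εP≤PδP)
  where
  instance
    _ : ℚ.Positive δ
    _ = ℚ.positive 0<δ
    _ : ℚ.Positive T
    _ = ℚ.positive 0<T
    _ : ℚ.Positive κ
    _ = ℚP.nonNeg∧nonZero⇒pos κ {{ℚ.nonNegative (nonNeg-*-pos⇒nonNeg κ P 0≤κP)}}
    _ : ℚ.Positive (1/ κ)
    _ = ℚP.1/pos⇒pos κ
  εP-pos : ℚ.Positive ((δ * T ÷ κ) * P)
  εP-pos = ℚP.pos*pos⇒pos (δ * T ÷ κ) {{ℚP.pos*pos⇒pos (δ * T) {{ℚP.pos*pos⇒pos δ T}} (1/ κ)}} P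

  PδP≡κP÷T*εP : P * (δ * P) ≡ (κ * P ÷ T) * ((δ * T ÷ κ) * P)
  PδP≡κP÷T*εP = begin
    P * (δ * P)                            ≡⟨ ℚP.*-identityʳ _ ⟨
    P * (δ * P) * 1ℚ                       ≡⟨ cong (P * (δ * P) *_) (ℚP.*-inverseʳ T) ⟨
    P * (δ * P) * (T * 1/ T)               ≡⟨ ℚP.*-identityʳ _ ⟨
    P * (δ * P) * (T * 1/ T) * 1ℚ          ≡⟨ cong (P * (δ * P) * (T * 1/ T) *_) (ℚP.*-inverseʳ κ) ⟨
    P * (δ * P) * (T * 1/ T) * (κ * 1/ κ)  ≡⟨ solve 6 (λ P δ κ T T⁻¹ κ⁻¹ →
                                                P :* (δ :* P) :* (T :* T⁻¹) :* (κ :* κ⁻¹)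
                                             := κ :* P :* T⁻¹ :* (δ :* T :* κ⁻¹ :* P)) refl P δ κ T (1/ T) (1/ κ) ⟩
    (κ * P ÷ T) * ((δ * T ÷ κ) * P)        ∎
    where
    open ≡-Reasoning
    open +-*-Solver using (solve; _:=_; _:*_)

module _ (p : ℕ) .{{_ : NonZero p}} where

  u+ₚv-ₚu≡v : (u v : Fin p) → _-ₚ_ p (_+ₚ_ p u v) u ≡ v
  u+ₚv-ₚu≡v u v = FinP.toℕ-injective (begin
    toℕ ((toℕ ((toℕ u ℕ.+ toℕ v) mod p) ℕ.+ (p ∸ toℕ u)) mod p)
      ≡⟨ FinP.toℕ-fromℕ< _ ⟩
    (toℕ ((toℕ u ℕ.+ toℕ v) mod p) ℕ.+ (p ∸ toℕ u)) % p
      ≡⟨ cong (λ w → (w ℕ.+ (p ∸ toℕ u)) % p) (FinP.toℕ-fromℕ< _) ⟩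
    ((toℕ u ℕ.+ toℕ v) % p ℕ.+ (p ∸ toℕ u)) % p
      ≡⟨ %-distribˡ-+ ((toℕ u ℕ.+ toℕ v) % p) (p ∸ toℕ u) p ⟩
    ((toℕ u ℕ.+ toℕ v) % p % p ℕ.+ (p ∸ toℕ u) % p) % p
      ≡⟨ cong (λ w → (w ℕ.+ (p ∸ toℕ u) % p) % p) (m%n%n≡m%n (toℕ u ℕ.+ toℕ v) p) ⟩
    ((toℕ u ℕ.+ toℕ v) % p ℕ.+ (p ∸ toℕ u) % p) % p
      ≡⟨ %-distribˡ-+ (toℕ u ℕ.+ toℕ v) (p ∸ toℕ u) p ⟨
    (toℕ u ℕ.+ toℕ v ℕ.+ (p ∸ toℕ u)) % p
      ≡⟨ cong (_% p) u+v+[p∸u]≡v+p ⟩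
    (toℕ v ℕ.+ p) % p
      ≡⟨ [m+n]%n≡m%n (toℕ v) p ⟩
    toℕ v % p
      ≡⟨ m<n⇒m%n≡m (FinP.toℕ<n v) ⟩
    toℕ v ∎)
    where
    open ≡-Reasoning
    u+v+[p∸u]≡v+p : toℕ u ℕ.+ toℕ v ℕ.+ (p ∸ toℕ u) ≡ toℕ v ℕ.+ p
    u+v+[p∸u]≡v+p = begin
      toℕ u ℕ.+ toℕ v ℕ.+ (p ∸ toℕ u)   ≡⟨ cong (ℕ._+ (p ∸ toℕ u)) (ℕP.+-comm (toℕ u) (toℕ v)) ⟩
      toℕ v ℕ.+ toℕ u ℕ.+ (p ∸ toℕ u)   ≡⟨ ℕP.+-assoc (toℕ v) (toℕ u) (p ∸ toℕ u) ⟩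
      toℕ v ℕ.+ (toℕ u ℕ.+ (p ∸ toℕ u)) ≡⟨ cong (toℕ v ℕ.+_) (ℕP.m+[n∸m]≡n (ℕP.<⇒≤ (FinP.toℕ<n u))) ⟩
      toℕ v ℕ.+ p                       ∎

  -- Double counting: (u , v) ↦ (u + v , u) sends the representations counted on the
  -- left injectively to the ones counted on the right.
  ∑-r+-≤-∑-r- : {W X : Subset p} (U V : Subset p) → W ⊆ X →
    ∑[ z < p ] (𝟙 (z ∈? W) ℕ.* r+ p U V z) ℕ.≤ ∑[ v < p ] (𝟙 (v ∈? V) ℕ.* r- p X U v)
  ∑-r+-≤-∑-r- {W} {X} U V W⊆X = begin
    ∑[ z < p ] (𝟙 (z ∈? W) ℕ.* r+ p U V z)
      ≡⟨ sum-cong-≗ (λ z → factor (z ∈? W) (representations+ z)) ⟩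
    ∑[ z < p ] ∑[ u < p ] ∑[ v < p ] (𝟙 (z ∈? W) ℕ.* 𝟙 (representations+ z (u , v)))
      ≡⟨ sum-cong-≗ (λ z → ∑-comm (λ u v → 𝟙 (z ∈? W) ℕ.* 𝟙 (representations+ z (u , v)))) ⟩
    ∑[ z < p ] ∑[ v < p ] ∑[ u < p ] (𝟙 (z ∈? W) ℕ.* 𝟙 (representations+ z (u , v)))
      ≡⟨ ∑-comm (λ z v → ∑[ u < p ] (𝟙 (z ∈? W) ℕ.* 𝟙 (representations+ z (u , v)))) ⟩
    ∑[ v < p ] ∑[ z < p ] ∑[ u < p ] (𝟙 (z ∈? W) ℕ.* 𝟙 (representations+ z (u , v)))
      ≤⟨ ∑-mono-≤ (λ v → ∑-mono-≤ (λ z → ∑-mono-≤ (λ u → pointwise z u v))) ⟩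
    ∑[ v < p ] ∑[ z < p ] ∑[ u < p ] (𝟙 (v ∈? V) ℕ.* 𝟙 (representations- v (z , u)))
      ≡⟨ sum-cong-≗ (λ v → factor (v ∈? V) (representations- v)) ⟨
    ∑[ v < p ] (𝟙 (v ∈? V) ℕ.* r- p X U v) ∎
    where
    open ℕP.≤-Reasoning
    representations+ : (z : Fin p) (uv : Fin p × Fin p) →
                       Dec (proj₁ uv ∈ U × (proj₂ uv ∈ V × _+ₚ_ p (proj₁ uv) (proj₂ uv) ≡ z))
    representations+ z (u , v) = (u ∈? U) ×-dec ((v ∈? V) ×-dec (FinP._≟_ (_+ₚ_ p u v) z))
    representations- : (v : Fin p) (zu : Fin p × Fin p) →
                       Dec (proj₁ zu ∈ X × (proj₂ zu ∈ U × _-ₚ_ p (proj₁ zu) (proj₂ zu) ≡ v))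
    representations- v (z , u) = (z ∈? X) ×-dec ((u ∈? U) ×-dec (FinP._≟_ (_-ₚ_ p z u) v))

    factor : ∀ {P : Fin p × Fin p → Set} (d : Dec A) (P? : Decidable P) →
      𝟙 d ℕ.* length (filter P? (cartesianProduct (allFin p) (allFin p)))
        ≡ ∑[ s < p ] ∑[ t < p ] (𝟙 d ℕ.* 𝟙 (P? (s , t)))
    factor d P? = begin-equality
      𝟙 d ℕ.* length (filter P? (cartesianProduct (allFin p) (allFin p)))
        ≡⟨ cong (𝟙 d ℕ.*_) (length-filter-pairs≡∑∑𝟙 P?) ⟩
      𝟙 d ℕ.* ∑[ s < p ] ∑[ t < p ] 𝟙 (P? (s , t))
        ≡⟨ *-distribˡ-sum (𝟙 d) (λ s → ∑[ t < p ] 𝟙 (P? (s , t))) ⟩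
      ∑[ s < p ] (𝟙 d ℕ.* ∑[ t < p ] 𝟙 (P? (s , t)))
        ≡⟨ sum-cong-≗ (λ s → *-distribˡ-sum (𝟙 d) (λ t → 𝟙 (P? (s , t)))) ⟩
      ∑[ s < p ] ∑[ t < p ] (𝟙 d ℕ.* 𝟙 (P? (s , t))) ∎

    pointwise : ∀ z u v → 𝟙 (z ∈? W) ℕ.* 𝟙 (representations+ z (u , v))
                       ℕ.≤ 𝟙 (v ∈? V) ℕ.* 𝟙 (representations- v (z , u))
    pointwise z u v = begin
      𝟙 (z ∈? W) ℕ.* 𝟙 (representations+ z (u , v))  ≡⟨ 𝟙-× (z ∈? W) (representations+ z (u , v)) ⟨
      𝟙 ((z ∈? W) ×-dec representations+ z (u , v))  ≤⟨ 𝟙-mono swap ((z ∈? W) ×-dec representations+ z (u , v))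
                                                                  ((v ∈? V) ×-dec representations- v (z , u)) ⟩
      𝟙 ((v ∈? V) ×-dec representations- v (z , u))  ≡⟨ 𝟙-× (v ∈? V) (representations- v (z , u)) ⟩
      𝟙 (v ∈? V) ℕ.* 𝟙 (representations- v (z , u))  ∎
      where
      swap : z ∈ W × (u ∈ U × (v ∈ V × _+ₚ_ p u v ≡ z)) → v ∈ V × (z ∈ X × (u ∈ U × _-ₚ_ p z u ≡ v))
      swap (z∈W , u∈U , v∈V , u+v≡z) = v∈V , W⊆X z∈W , u∈U , subst (λ w → _-ₚ_ p w u ≡ v) u+v≡z (u+ₚv-ₚu≡v u v)

  ε*p≤r+ : ∀ U V ε {z} → z ∈ sumε p U ε V → ε * ⟦ p ⟧ ≤ ⟦ r+ p U V z ⟧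
  ε*p≤r+ U V ε z∈ =
    proj₁ (∈-tabulate-does⁻ (λ z → (ε * ⟦ p ⟧ ℚP.≤? ⟦ r+ p U V z ⟧) ×-dec (r+ p U V z ℕ.>? 0)) z∈)

  r-≤ε*p : ∀ U V {ε z} → 0ℚ ≤ ε → z ∉ diffε p U ε V → ⟦ r- p U V z ⟧ ≤ ε * ⟦ p ⟧
  r-≤ε*p U V {ε} {z} 0≤ε z∉ = ¬[a≤⟦k⟧×k>0]⇒⟦k⟧≤a (r- p U V z) (0≤*⟦⟧ p 0≤ε)
    (∉-tabulate-does⁻ (λ z → (ε * ⟦ p ⟧ ℚP.≤? ⟦ r- p U V z ⟧) ×-dec (r- p U V z ℕ.>? 0)) z∉)

  -- The summands are passed explicitly: inferring them by unification under ⟦_⟧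
  -- makes Agda normalise the gcds inside ℚ's normal forms and run out of memory.
  ∣X∩sumε∣-bound : ∀ δ ε (X Y : Subset p) → 0ℚ ≤ δ →
    ⟦ ∣ X ∩ sumε p Y ε (∁ (diffε p X δ Y)) ∣ ⟧ * (ε * ⟦ p ⟧) ≤ ⟦ p ⟧ * (δ * ⟦ p ⟧)
  ∣X∩sumε∣-bound δ ε X Y 0≤δ = begin
    ⟦ ∣ E ∣ ⟧ * (ε * ⟦ p ⟧)
      ≡⟨ cong (λ k → ⟦ k ⟧ * (ε * ⟦ p ⟧)) (∣∣≡∑𝟙 E) ⟩
    ⟦ ∑[ z < p ] 𝟙 (z ∈? E) ⟧ * (ε * ⟦ p ⟧)
      ≤⟨ ⟦∑⟧*-≤-⟦∑⟧ (ε * ⟦ p ⟧) (λ z → 𝟙 (z ∈? E)) (λ z → 𝟙 (z ∈? E) ℕ.* r+ p Y C z)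
           (λ z → ⟦𝟙⟧*-≤-⟦𝟙*⟧ {k = r+ p Y C z} (z ∈? E) (ε*p≤r+ Y C ε ∘ proj₂ ∘ x∈p∩q⁻ X S)) ⟩
    ⟦ ∑[ z < p ] (𝟙 (z ∈? E) ℕ.* r+ p Y C z) ⟧
      ≤⟨ ⟦⟧-mono-≤ {∑[ z < p ] (𝟙 (z ∈? E) ℕ.* r+ p Y C z)} {∑[ c < p ] (𝟙 (c ∈? C) ℕ.* r- p X Y c)}
           (∑-r+-≤-∑-r- Y C (p∩q⊆p X S)) ⟩
    ⟦ ∑[ c < p ] (𝟙 (c ∈? C) ℕ.* r- p X Y c) ⟧
      ≤⟨ ⟦∑⟧-≤-⟦n⟧* (δ * ⟦ p ⟧) (λ c → 𝟙 (c ∈? C) ℕ.* r- p X Y c)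
           (λ c → ⟦𝟙*⟧-≤ {k = r- p X Y c} (c ∈? C) (0≤*⟦⟧ p 0≤δ) (r-≤ε*p X Y 0≤δ ∘ x∈∁p⇒x∉p)) ⟩
    ⟦ p ⟧ * (δ * ⟦ p ⟧) ∎
    where
    open ℚP.≤-Reasoning
    C S E : Subset p
    C = ∁ (diffε p X δ Y)
    S = sumε p Y ε C
    E = X ∩ S

proposition10 : (p : ℕ) .{{_ : NonZero p}} → Prime p →
    (δ T : ℚ) → 0ℚ < δ → δ < 1ℚ → 1ℚ < T → .{{_ : ℚ.NonZero T}} →
    (X Y : Subset p) → (κ : ℚ) .{{_ : ℚ.NonZero κ}} → ⟦ ∣ X ∣ ⟧ ≡ κ * ⟦ p ⟧ →
    Σ (Subset p) λ E →
      (⟦ ∣ E ∣ ⟧ ≤ ⟦ ∣ X ∣ ⟧ ÷ T)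
      × ((X ─ E) ∩ sumε p Y ((δ * T) ÷ κ) (∁ (diffε p X δ Y)) ≡ ⊥)
proposition10 p _ δ T 0<δ _ 1<T X Y κ ∣X∣≡κp = X ∩ S , ∣E∣≤∣X∣÷T , [p─[p∩q]]∩q≡⊥ X S
  where
  S : Subset p
  S = sumε p Y ((δ * T) ÷ κ) (∁ (diffε p X δ Y))
  ∣E∣≤∣X∣÷T : ⟦ ∣ X ∩ S ∣ ⟧ ≤ ⟦ ∣ X ∣ ⟧ ÷ T
  ∣E∣≤∣X∣÷T = subst (λ x → ⟦ ∣ X ∩ S ∣ ⟧ ≤ x ÷ T) (sym ∣X∣≡κp)
    (e*[δT÷κ*P]≤P*[δ*P]⇒e≤κP÷T ⟦ ∣ X ∩ S ∣ ⟧ δ T κ ⟦ p ⟧ {{ℚP.normalize-pos p 1}}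
      0<δ (ℚP.<-trans (ℚP.positive⁻¹ 1ℚ) 1<T) (subst (0ℚ ≤_) ∣X∣≡κp (⟦⟧-nonNeg ∣ X ∣))
      (∣X∩sumε∣-bound p δ ((δ * T) ÷ κ) X Y (ℚP.<⇒≤ 0<δ)))
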